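{- Let $t$ be a rooted tree. Then $t$ has exactly $m(\bullet;t)$ labellings, and exactly $n(\bullet;t)$ equivalence classes of labellings.
   Context: A rooted tree is a finite partially ordered set (elements called vertices) with a unique greatest element, the root, such that for every vertex $v$ the set of vertices greater than $v$ is a chain; $w$ is a descendant of $v$ if $w<v$, and if $v$ covers $w$, $w$ is a child of $v$. We regard it as a directed graph with edges from each vertex to its children; a vertex is terminal if it has no children. Rooted trees are considered up to isomorphism; $V(t)$ is the vertex set, $|t|$ the number of vertices, $\bullet$ the one-vertex tree. Write $t\lhd t'$ if $t$ is obtained from $t'$ by deleting one terminal non-root vertex and the edge into it. For $t\lhd t'$, $n_1(t;t')$ is the number of vertices of $t$ at which attaching a new edge to a new terminal vertex yields $t'$, and $m_1(t;t')$ is the number of edges of $t'$ whose removal (with their terminal endpoint) leaves $t$. Let $k$ be a field of characteristic $0$ and $k\{\mathcal T\}$ the vector space with basis the rooted trees; the linear operators $\mathfrak N(t)=\sum_{t\lhd t'}n_1(t;t')t'$ and $\mathfrak P(t)=\sum_{t'\lhd t}m_1(t';t)t'$ ($\mathfrak P(\bullet)=0$). For rooted trees with $|t'|-|t|=j\ge 0$, $n(t;t')$ is the coefficient of $t'$ in $\mathfrak N^j(t)$ and $m(t;t')$ is the coefficient of $t$ in $\mathfrak P^j(t')$. For a vertex $v$ of $t$, $t_v$ is the rooted tree of $v$ and its descendants; if $v$ has children $v_1,\dots,v_k$, $SG(t,v)$ is the group of permutations of vertices generated by the exchanges of the branches $t_{v_i}$ and $t_{v_j}$ whenever these are isomorphic;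 $SG(t)=\prod_v SG(t,v)$, acting on $V(t)$. A labelling of $t$ is a bijection $f:V(t)\to\{0,1,\dots,|t|-1\}$ such that $f(v)>f(w)$ whenever $v$ is a descendant of $w$. Labellings $f,g$ are equivalent if $f\circ\phi=g$ for some $\phi\in SG(t)$. -}

module Defs where

open import Data.Nat using (ℕ; zero; suc)
open import Data.Fin using (Fin; _≟_; punchIn) renaming (_<_ to _<ᶠ_)
open import Data.List using (List; []; _∷_; map; concatMap; mapMaybe; allFin)
open import Data.Nat.ListAction using (sum)
open import Data.Maybe using (Maybe; just; nothing)
import Data.Maybe as Maybe
open import Data.Product using (Σ; ∃; _×_)
open import Data.Bool using (if_then_else_)
open import Relation.Nullary using (¬_; does)
open import Relation.Binary.PropositionalEquality using (_≡_)
open import Function.Definitions using (Bijective)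
open import Data.Fin.Permutation using (Permutation′; _⟨$⟩ʳ_)

-- The child order is only a
-- presentation: trees are compared up to isomorphism (Iso below).

data Tree : Set where
  node : (k : ℕ) → (Fin k → Tree) → Tree

• : Tree
• = node zero (λ ())

size : Tree → ℕ
size (node k f) = suc (sum (map (λ i → size (f i)) (allFin k)))

data Pos : Tree → Set where
  root : ∀ {k f} → Pos (node k f)
  sub  : ∀ {k f} (i : Fin k) → Pos (f i) → Pos (node k f)

-- v ⊏ w : v is a descendant of w (v < w in the tree order)
data _⊏_ : {t : Tree} → Pos t → Pos t → Set where
  below-root : ∀ {k f} {i : Fin k} {p : Pos (f i)} →
               _⊏_ {node k f} (sub i p) root
  below-sub  : ∀ {k f} {i : Fin k} {p q : Pos (f i)} →
               p ⊏ q → _⊏_ {node k f} (sub i p) (sub i q)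

vertices : (t : Tree) → List (Pos t)
vertices (node k f) =
  root ∷ concatMap (λ i → map (sub i) (vertices (f i))) (allFin k)

data Iso : Tree → Tree → Set where
  iso : ∀ {k f g} (π : Permutation′ k) →
        ((i : Fin k) → Iso (f i) (g (π ⟨$⟩ʳ i))) →
        Iso (node k f) (node k g)

act : ∀ {s t} → Iso s t → Pos s → Pos t
act (iso π h) root      = root
act (iso π h) (sub i p) = sub (π ⟨$⟩ʳ i) (act (h i) p)

SG : Tree → Set
SG t = Iso t t

-- Linear combinations with nonnegative integer coefficients are
-- represented as lists of trees (formal sums); the coefficient of the
-- basis element [t] in a list is the number of entries isomorphic to t.

data Coeff (t : Tree) : List Tree → ℕ → Set where
  c-nil  : Coeff t [] zero
  c-yes  : ∀ {x xs c} → Iso t x → Coeff t xs c → Coeff t (x ∷ xs) (suc c)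
  c-no   : ∀ {x xs c} → ¬ Iso t x → Coeff t xs c → Coeff t (x ∷ xs) c

upd : ∀ {k} → (Fin k → Tree) → Fin k → Tree → (Fin k → Tree)
upd f i t j = if does (j ≟ i) then t else f j

snoc : ∀ {k} → (Fin k → Tree) → (Fin (suc k) → Tree)
snoc {zero}  f Fin.zero    = •
snoc {suc k} f Fin.zero    = f Fin.zero
snoc {suc k} f (Fin.suc j) = snoc (λ x → f (Fin.suc x)) j

graft : (t : Tree) → Pos t → Tree
graft (node k f) root      = node (suc k) (snoc f)
graft (node k f) (sub i p) = node k (upd f i (graft (f i) p))

-- delete vertex v and the edge into it, if v is terminal and not the root
mutual
  removeLeaf : (t : Tree) → Pos t → Maybe Tree
  removeLeaf (node k f) root = nothing
  removeLeaf (node (suc k) f) (sub i p) =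
    removeIn (f i) p (λ t' → node (suc k) (upd f i t'))
                     (node k (λ j → f (punchIn i j)))

  -- s is the branch of a child c of the current vertex; v a vertex of s;
  -- 'rebuild' puts a modified branch back, 'del' is the tree with c deleted
  removeIn : (s : Tree) → Pos s → (Tree → Tree) → Tree → Maybe Tree
  removeIn (node zero g)    root rebuild del = just del
  removeIn (node (suc _) g) root rebuild del = nothing
  removeIn (node k g) (sub j q) rebuild del =
    Maybe.map rebuild (removeLeaf (node k g) (sub j q))

-- 𝔑(t) = Σ_{t ⊲ t'} n₁(t;t') t'  = Σ_{v ∈ V(t)} (t with a leaf grafted at v)
𝔑 : Tree → List Tree
𝔑 t = map (graft t) (vertices t)

-- 𝔓(t) = Σ_{t' ⊲ t} m₁(t';t) t' = Σ over edges into terminal vertices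
𝔓 : Tree → List Tree
𝔓 t = mapMaybe (removeLeaf t) (vertices t)

𝔑* : List Tree → List Tree
𝔑* = concatMap 𝔑

𝔓* : List Tree → List Tree
𝔓* = concatMap 𝔓

iter : {A : Set} → ℕ → (A → A) → A → A
iter zero    g a = a
iter (suc n) g a = g (iter n g a)

record Labelling (t : Tree) : Set where
  constructor labelling
  field
    lab       : Pos t → Fin (size t)
    bijective : Bijective _≡_ _≡_ lab
    decreasing : ∀ {v w : Pos t} → v ⊏ w → lab w <ᶠ lab v

open Labelling public

_≐_ : ∀ {t} → Labelling t → Labelling t → Set
f ≐ g = ∀ v → lab f v ≡ lab g v

_∼_ : ∀ {t} → Labelling t → Labelling t → Set
_∼_ {t} f g = Σ (SG t) λ φ → ∀ v → lab f (act φ v) ≡ lab g v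

HasCard : (A : Set) → (A → A → Set) → ℕ → Set
HasCard A _~_ N =
  Σ (Fin N → A) λ e →
    (∀ i j → e i ~ e j → i ≡ j) × (∀ a → ∃ λ i → e i ~ a)

{-# OPTIONS --safe #-}
-- The vertex with the largest label of a labelling is a terminal non-root vertex; deleting it leaves a
-- labelling of the smaller tree, and conversely a labelling of t minus a leaf extends uniquely by giving
-- the leaf the largest label. So labellings satisfy the recursion that defines m(•;t) through 𝔓.
--
-- Dually, recording at each step the vertex to which the next label is attached yields a growth code;
-- the trees grown from codes are exactly the terms of 𝔑ⁿ(•), each with a canonical labelling. Two
-- labellings of t are SG(t)-equivalent iff they induce the same order on the labels (an order
-- isomorphism of vertex sets is a tree isomorphism), iff they have the same code. So the classes
-- correspond to the codes growing a tree isomorphic to t, counted by n(•;t); isomorphism with t is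
-- decidable because it amounts to comparing orders with the finitely many labellings of t.
module Submission where

open import Defs
open import Data.Nat as ℕ using (ℕ; zero; suc; _+_; _∸_)
import Data.Nat.Properties as ℕ
open import Data.Nat.ListAction using (sum)
open import Data.Fin as Fin using (Fin; zero; suc; fromℕ; inject₁; punchIn; _≟_)
  renaming (_<_ to _<ᶠ_)
import Data.Fin.Properties as Fin
open import Data.Fin.Relation.Unary.Top
  using (View; view; ‵fromℕ; ‵inject₁; view-fromℕ; view-inject₁)
open import Data.List
  using (List; []; _∷_; map; length; lookup; _++_; concatMap; mapMaybe; allFin; filter)
import Data.List.Properties as List
open import Data.List.Membership.Propositional using (_∈_; _∉_)
import Data.List.Membership.Propositional.Properties as ∈
open import Data.List.Membership.Propositional.Properties.WithK using (unique∧set⇒bag)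
open import Data.List.Relation.Unary.Any using (here; there; index)
import Data.List.Relation.Unary.Any.Properties as Any
open import Data.List.Relation.Unary.All as All using (All; []; _∷_)
import Data.List.Relation.Unary.All.Properties as All
open import Data.List.Relation.Unary.AllPairs as AllPairs using ([]; _∷_)
import Data.List.Relation.Unary.AllPairs.Properties as AllPairs
open import Data.List.Relation.Unary.Unique.Propositional using (Unique)
import Data.List.Relation.Unary.Unique.Propositional.Properties as Unique
open import Data.List.Relation.Binary.Disjoint.Propositional using (Disjoint)
open import Data.List.Relation.Binary.BagAndSetEquality using (∼bag⇒↭)
open import Data.List.Relation.Binary.Permutation.Propositional.Properties using (↭-length)
open import Data.Fin.Permutation as Perm using (Permutation; Permutation′; _⟨$⟩ʳ_; _⟨$⟩ˡ_)
open import Data.Maybe using (Maybe; just; nothing; maybe)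
import Data.Maybe.Relation.Unary.All as MaybeAll
open MaybeAll using (just; nothing)
open import Data.Product using (Σ; ∃; _×_; _,_; proj₁; proj₂)
open import Data.Sum using (_⊎_; inj₁; inj₂)
open import Data.Empty using (⊥-elim)
open import Data.Unit using (⊤; tt)
open import Function using (_∘_; id; _on_; case_of_; _⇔_; mk⇔; Equivalence)
import Function.Properties.Equivalence as ⇔
open import Relation.Nullary using (¬_; Dec; yes; no; contradiction)
import Relation.Nullary.Decidable as Dec
open import Relation.Nullary.Decidable using (_×-dec_; _→-dec_)
open import Relation.Binary.PropositionalEquality
open import Relation.Binary.Structures using (IsEquivalence)
import Relation.Binary.Construct.On as On
open import Data.Sum.Relation.Binary.Pointwise using (Pointwise; inj₁; inj₂; ⊎-isEquivalence)

infix 4 _⊑_ _⊏?_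

_⊑_ : ∀ {t} → Pos t → Pos t → Set
x ⊑ y = x ≡ y ⊎ x ⊏ y

rootOf : (t : Tree) → Pos t
rootOf (node k f) = root

⊏-irrefl : ∀ {t} {x : Pos t} → ¬ x ⊏ x
⊏-irrefl (below-sub x⊏x) = ⊏-irrefl x⊏x

⊏-trans : ∀ {t} {x y z : Pos t} → x ⊏ y → y ⊏ z → x ⊏ z
⊏-trans (below-sub x⊏y) below-root    = below-root
⊏-trans (below-sub x⊏y) (below-sub y⊏z) = below-sub (⊏-trans x⊏y y⊏z)

⊑-⊏-trans : ∀ {t} {x y z : Pos t} → x ⊑ y → y ⊏ z → x ⊏ z
⊑-⊏-trans (inj₁ refl) y⊏z = y⊏z
⊑-⊏-trans (inj₂ x⊏y) y⊏z = ⊏-trans x⊏y y⊏z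

⊑-trans : ∀ {t} {x y z : Pos t} → x ⊑ y → y ⊑ z → x ⊑ z
⊑-trans x⊑y (inj₁ refl) = x⊑y
⊑-trans x⊑y (inj₂ y⊏z) = inj₂ (⊑-⊏-trans x⊑y y⊏z)

⊑-antisym : ∀ {t} {x y : Pos t} → x ⊑ y → y ⊑ x → x ≡ y
⊑-antisym (inj₁ x≡y) _           = x≡y
⊑-antisym (inj₂ x⊏y) (inj₁ y≡x) = sym y≡x
⊑-antisym (inj₂ x⊏y) (inj₂ y⊏x) = ⊥-elim (⊏-irrefl (⊏-trans x⊏y y⊏x))

⊑-rootOf : ∀ {t} (x : Pos t) → x ⊑ rootOf t
⊑-rootOf root      = inj₁ refl
⊑-rootOf (sub i p) = inj₂ below-root

rootOf-⊏-maximal : ∀ {t} {y : Pos t} → ¬ rootOf t ⊏ y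
rootOf-⊏-maximal {node k f} ()

sub-injectiveˡ : ∀ {k f} {i j : Fin k} {p : Pos (f i)} {q : Pos (f j)} →
                 _≡_ {A = Pos (node k f)} (sub i p) (sub j q) → i ≡ j
sub-injectiveˡ refl = refl

sub-injectiveʳ : ∀ {k f} {i : Fin k} {p q : Pos (f i)} →
                 _≡_ {A = Pos (node k f)} (sub i p) (sub i q) → p ≡ q
sub-injectiveʳ refl = refl

below-sub-index : ∀ {k f} {i j : Fin k} {p : Pos (f i)} {q : Pos (f j)} →
                  _⊏_ {node k f} (sub i p) (sub j q) → i ≡ j
below-sub-index (below-sub _) = refl

below-sub⁻¹ : ∀ {k f} {i : Fin k} {p q : Pos (f i)} → _⊏_ {node k f} (sub i p) (sub i q) → p ⊏ q
below-sub⁻¹ (below-sub p⊏q) = p⊏q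

_⊏?_ : ∀ {t} (x y : Pos t) → Dec (x ⊏ y)
root    ⊏? y    = no λ ()
sub i p ⊏? root = yes below-root
sub i p ⊏? sub j q with i ≟ j
... | no i≢j = no (i≢j ∘ below-sub-index)
... | yes refl with p ⊏? q
...   | yes p⊏q = yes (below-sub p⊏q)
...   | no p⊄q  = no (p⊄q ∘ below-sub⁻¹)

subst-⊏ : ∀ {s t} (s≡t : s ≡ t) {x y : Pos s} → x ⊏ y → subst Pos s≡t x ⊏ subst Pos s≡t y
subst-⊏ refl x⊏y = x⊏y

subst-⊏⁻¹ : ∀ {s t} (s≡t : s ≡ t) {x y : Pos s} →
            subst Pos s≡t x ⊏ subst Pos s≡t y → x ⊏ y
subst-⊏⁻¹ refl x⊏y = x⊏y

length-unique-complete : ∀ {A : Set} {xs ys : List A} → Unique xs → Unique ys →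
                         (∀ x → x ∈ xs) → (∀ y → y ∈ ys) → length xs ≡ length ys
length-unique-complete xs! ys! ∈xs ∈ys =
  ↭-length (∼bag⇒↭ (unique∧set⇒bag xs! ys! λ {z} →
    mk⇔ (λ _ → ∈ys z) (λ _ → ∈xs z)))

length-concatMap : ∀ {A B : Set} (g : A → List B) xs →
                   length (concatMap g xs) ≡ sum (map (length ∘ g) xs)
length-concatMap g []       = refl
length-concatMap g (x ∷ xs) =
  trans (List.length-++ (g x)) (cong (length (g x) +_) (length-concatMap g xs))

∈-concatMap-map : ∀ {A B : Set} {C : A → Set} (g : ∀ x → C x → B) {ys : ∀ x → List (C x)}
                  {xs x y} → x ∈ xs → y ∈ ys x → g x y ∈ concatMap (λ x → map (g x) (ys x)) xs
∈-concatMap-map g x∈xs y∈ys = ∈.∈-concat⁺′ (∈.∈-map⁺ (g _) y∈ys) (∈.∈-map⁺ _ x∈xs)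

unique-concatMap-map : ∀ {A B : Set} {C : A → Set} (g : ∀ x → C x → B) →
                       (∀ {x x′ y y′} → g x y ≡ g x′ y′ → x ≡ x′) →
                       (∀ {x y y′} → g x y ≡ g x y′ → y ≡ y′) →
                       ∀ {xs} (ys : ∀ x → List (C x)) → Unique xs → (∀ x → Unique (ys x)) →
                       Unique (concatMap (λ x → map (g x) (ys x)) xs)
unique-concatMap-map g g-injectiveˡ g-injectiveʳ ys xs! ys! =
  Unique.concat⁺ (All.map⁺ (All.universal (λ x → Unique.map⁺ g-injectiveʳ (ys! x)) _))
                 (AllPairs.map⁺ (AllPairs.map disjoint xs!))
  where
  disjoint : ∀ {x x′} → x ≢ x′ → Disjoint (map (g x) (ys x)) (map (g x′) (ys x′))
  disjoint x≢x′ (z∈ , z∈′) with ∈.∈-map⁻ (g _) z∈ | ∈.∈-map⁻ (g _) z∈′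
  ... | _ , _ , refl | _ , _ , eq = x≢x′ (g-injectiveˡ eq)

vertices-complete : ∀ {t} (x : Pos t) → x ∈ vertices t
vertices-complete root      = here refl
vertices-complete (sub i p) = there (∈-concatMap-map sub (∈.∈-allFin i) (vertices-complete p))

vertices-unique : ∀ t → Unique (vertices t)
vertices-unique (node k f) =
  All.tabulate (λ { root∈ refl → root∉ root∈ })
  ∷ unique-concatMap-map sub sub-injectiveˡ sub-injectiveʳ (vertices ∘ f)
                         (Unique.allFin⁺ k) (vertices-unique ∘ f)
  where
  root∉ : root ∉ concatMap (λ i → map (sub i) (vertices (f i))) (allFin k)
  root∉ root∈ with ∈.∈-concat⁻′ (map (λ i → map (sub i) (vertices (f i))) (allFin k)) root∈
  ... | _ , root∈xs , xs∈ with ∈.∈-map⁻ (λ i → map (sub i) (vertices (f i))) xs∈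
  ...   | i , _ , refl with ∈.∈-map⁻ (sub i) root∈xs
  ...     | _ , _ , ()

length-vertices : ∀ t → length (vertices t) ≡ size t
length-vertices (node k f) = cong suc (begin
  length (concatMap branch (allFin k))          ≡⟨ length-concatMap branch (allFin k) ⟩
  sum (map (length ∘ branch) (allFin k))        ≡⟨ cong sum (List.map-cong length-branch (allFin k)) ⟩
  sum (map (λ i → size (f i)) (allFin k))       ∎)
  where
  open ≡-Reasoning
  branch : Fin k → List (Pos (node k f))
  branch i = map (sub i) (vertices (f i))
  length-branch : ∀ i → length (branch i) ≡ size (f i)
  length-branch i = trans (List.length-map (sub {f = f} i) (vertices (f i))) (length-vertices (f i))

-- Attaching a terminal vertex

record _⊲[_]_ (s : Tree) (v : Pos s) (t : Tree) : Set where
  field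
    embed           : Pos s → Pos t
    leaf            : Pos t
    embed-injective : ∀ {a b} → embed a ≡ embed b → a ≡ b
    embed≢leaf      : ∀ a → embed a ≢ leaf
    embed-or-leaf   : ∀ x → (∃ λ a → embed a ≡ x) ⊎ leaf ≡ x
    embed-⊏⁺        : ∀ {a b} → a ⊏ b → embed a ⊏ embed b
    embed-⊏⁻        : ∀ {a b} → embed a ⊏ embed b → a ⊏ b
    leaf-⊏⁺         : ∀ {b} → v ⊑ b → leaf ⊏ embed b
    leaf-⊏⁻         : ∀ {b} → leaf ⊏ embed b → v ⊑ b
    leaf-terminal   : ∀ {x} → ¬ x ⊏ leaf

open _⊲[_]_ using (leaf)

size-⊲ : ∀ {s v t} → s ⊲[ v ] t → size t ≡ suc (size s)
size-⊲ {s} {v} {t} E = begin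
  size t                                     ≡⟨ length-vertices t ⟨
  length (vertices t)                        ≡⟨ length-unique-complete (vertices-unique t) unique
                                                                       vertices-complete complete ⟩
  length (E.leaf ∷ map E.embed (vertices s)) ≡⟨ cong suc (List.length-map E.embed (vertices s)) ⟩
  suc (length (vertices s))                  ≡⟨ cong suc (length-vertices s) ⟩
  suc (size s)                               ∎
  where
  open ≡-Reasoning
  module E = _⊲[_]_ E
  unique : Unique (E.leaf ∷ map E.embed (vertices s))
  unique = All.tabulate leaf∉ ∷ Unique.map⁺ E.embed-injective (vertices-unique s)
    where
    leaf∉ : ∀ {x} → x ∈ map E.embed (vertices s) → E.leaf ≢ x
    leaf∉ x∈ leaf≡x with ∈.∈-map⁻ E.embed x∈
    ... | a , _ , refl = E.embed≢leaf a (sym leaf≡x)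
  complete : ∀ x → x ∈ E.leaf ∷ map E.embed (vertices s)
  complete x with E.embed-or-leaf x
  ... | inj₁ (a , refl) = there (∈.∈-map⁺ E.embed (vertices-complete a))
  ... | inj₂ refl       = here refl

Edgeless : Tree → Set
Edgeless s = ∀ {x y : Pos s} → ¬ x ⊏ y

edgeless-rootOf : ∀ {s} → Edgeless s → (x : Pos s) → rootOf s ≡ x
edgeless-rootOf edgeless x with ⊑-rootOf x
... | inj₁ x≡root = sym x≡root
... | inj₂ x⊏root = ⊥-elim (edgeless x⊏root)

module _ {k} {f : Fin k → Tree} {g : Fin (suc k) → Tree} (m : Fin (suc k))
         (f≡g : ∀ i → f i ≡ g (punchIn m i)) (edgeless : Edgeless (g m)) where

  leafChild-⊲ : node k f ⊲[ root ] node (suc k) g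
  leafChild-⊲ = record
    { embed = embed′ ; leaf = sub m (rootOf (g m))
    ; embed-injective = embed-injective ; embed≢leaf = embed≢leaf
    ; embed-or-leaf = embed-or-leaf ; embed-⊏⁺ = embed-⊏⁺ ; embed-⊏⁻ = embed-⊏⁻
    ; leaf-⊏⁺ = leaf-⊏⁺ ; leaf-⊏⁻ = leaf-⊏⁻ ; leaf-terminal = leaf-terminal }
    where
    embed′ : Pos (node k f) → Pos (node (suc k) g)
    embed′ root      = root
    embed′ (sub i p) = sub (punchIn m i) (subst Pos (f≡g i) p)

    embed-injective : ∀ {a b} → embed′ a ≡ embed′ b → a ≡ b
    embed-injective {root}    {root}    _ = refl
    embed-injective {sub i p} {sub j q} e with Fin.punchIn-injective m i j (sub-injectiveˡ e)
    ... | refl = cong (sub i) (subst-injective (f≡g i) (sub-injectiveʳ e))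

    embed≢leaf : ∀ a → embed′ a ≢ sub m (rootOf (g m))
    embed≢leaf (sub i p) e = Fin.punchInᵢ≢i m i (sub-injectiveˡ e)

    preimage : ∀ {i j} → punchIn m i ≡ j → (y : Pos (g j)) → ∃ λ a → embed′ a ≡ sub j y
    preimage {i} refl y = sub i (subst Pos (sym (f≡g i)) y) , cong (sub _) (subst-subst-sym (f≡g i))

    embed-or-leaf : ∀ x → (∃ λ a → embed′ a ≡ x) ⊎ sub m (rootOf (g m)) ≡ x
    embed-or-leaf root = inj₁ (root , refl)
    embed-or-leaf (sub j y) with m ≟ j
    ... | yes refl = inj₂ (cong (sub m) (edgeless-rootOf edgeless y))
    ... | no m≢j   = inj₁ (preimage (Fin.punchIn-punchOut m≢j) y)

    embed-⊏⁺ : ∀ {a b} → a ⊏ b → embed′ a ⊏ embed′ b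
    embed-⊏⁺ below-root      = below-root
    embed-⊏⁺ (below-sub p⊏q) = below-sub (subst-⊏ (f≡g _) p⊏q)

    embed-⊏⁻ : ∀ {a b} → embed′ a ⊏ embed′ b → a ⊏ b
    embed-⊏⁻ {sub i p} {root}    _ = below-root
    embed-⊏⁻ {sub i p} {sub j q} r with Fin.punchIn-injective m i j (below-sub-index r)
    ... | refl = below-sub (subst-⊏⁻¹ (f≡g i) (below-sub⁻¹ r))

    leaf-⊏⁺ : ∀ {b} → root ⊑ b → sub m (rootOf (g m)) ⊏ embed′ b
    leaf-⊏⁺ (inj₁ refl) = below-root

    leaf-⊏⁻ : ∀ {b} → sub m (rootOf (g m)) ⊏ embed′ b → root ⊑ b
    leaf-⊏⁻ {root}    _ = inj₁ refl
    leaf-⊏⁻ {sub i p} r = ⊥-elim (Fin.punchInᵢ≢i m i (sym (below-sub-index r)))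

    leaf-terminal : ∀ {x} → ¬ x ⊏ sub m (rootOf (g m))
    leaf-terminal (below-sub y⊏root) = edgeless y⊏root

module _ {k} {f g : Fin k → Tree} (i : Fin k) (f≡g : ∀ j → j ≢ i → f j ≡ g j)
         {v : Pos (f i)} (E : f i ⊲[ v ] g i) where

  private
    module E = _⊲[_]_ E

    branch : ∀ j → Pos (f j) → Pos (g j)
    branch j p with j ≟ i
    ... | yes refl = E.embed p
    ... | no j≢i   = subst Pos (f≡g j j≢i) p

    branch-i : ∀ p → branch i p ≡ E.embed p
    branch-i p with i ≟ i
    ... | yes refl = refl
    ... | no i≢i   = contradiction refl i≢i

    branch-surjective : ∀ {j} → j ≢ i → (y : Pos (g j)) → ∃ λ p → branch j p ≡ y
    branch-surjective {j} j≢i y with j ≟ i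
    ... | yes j≡i  = contradiction j≡i j≢i
    ... | no j≢i′ = subst Pos (sym (f≡g j j≢i′)) y , subst-subst-sym (f≡g j j≢i′)

    branch-injective : ∀ j {p q} → branch j p ≡ branch j q → p ≡ q
    branch-injective j e with j ≟ i
    ... | yes refl = E.embed-injective e
    ... | no j≢i   = subst-injective (f≡g j j≢i) e

    branch-⊏⁺ : ∀ j {p q} → p ⊏ q → branch j p ⊏ branch j q
    branch-⊏⁺ j p⊏q with j ≟ i
    ... | yes refl = E.embed-⊏⁺ p⊏q
    ... | no j≢i   = subst-⊏ (f≡g j j≢i) p⊏q

    branch-⊏⁻ : ∀ j {p q} → branch j p ⊏ branch j q → p ⊏ q
    branch-⊏⁻ j r with j ≟ i
    ... | yes refl = E.embed-⊏⁻ r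
    ... | no j≢i   = subst-⊏⁻¹ (f≡g j j≢i) r

    embed′ : Pos (node k f) → Pos (node k g)
    embed′ root      = root
    embed′ (sub j p) = sub j (branch j p)

    leaf′ : Pos (node k g)
    leaf′ = sub i E.leaf

    leaf-⊏-branch⁺ : ∀ {q} → v ⊑ q → E.leaf ⊏ branch i q
    leaf-⊏-branch⁺ v⊑q = subst (E.leaf ⊏_) (sym (branch-i _)) (E.leaf-⊏⁺ v⊑q)

    leaf-⊏-branch⁻ : ∀ {q} → E.leaf ⊏ branch i q → v ⊑ q
    leaf-⊏-branch⁻ r = E.leaf-⊏⁻ (subst (E.leaf ⊏_) (branch-i _) r)

  branch-⊲ : node k f ⊲[ sub i v ] node k g
  branch-⊲ = record
    { embed = embed′ ; leaf = leaf′
    ; embed-injective = embed-injective ; embed≢leaf = embed≢leaf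
    ; embed-or-leaf = embed-or-leaf ; embed-⊏⁺ = embed-⊏⁺ ; embed-⊏⁻ = embed-⊏⁻
    ; leaf-⊏⁺ = leaf-⊏⁺ ; leaf-⊏⁻ = leaf-⊏⁻ ; leaf-terminal = leaf-terminal }
    where
    embed-injective : ∀ {a b} → embed′ a ≡ embed′ b → a ≡ b
    embed-injective {root}    {root}    _ = refl
    embed-injective {sub j p} {sub j′ q} e with sub-injectiveˡ e
    ... | refl = cong (sub j) (branch-injective j (sub-injectiveʳ e))

    embed≢leaf : ∀ a → embed′ a ≢ leaf′
    embed≢leaf (sub j p) e with sub-injectiveˡ e
    ... | refl = E.embed≢leaf p (trans (sym (branch-i p)) (sub-injectiveʳ e))

    embed-or-leaf : ∀ x → (∃ λ a → embed′ a ≡ x) ⊎ leaf′ ≡ x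
    embed-or-leaf root = inj₁ (root , refl)
    embed-or-leaf (sub j y) with j ≟ i
    ... | no j≢i = let p , e = branch-surjective j≢i y in inj₁ (sub j p , cong (sub j) e)
    ... | yes refl with E.embed-or-leaf y
    ...   | inj₁ (p , refl) = inj₁ (sub i p , cong (sub i) (branch-i p))
    ...   | inj₂ refl       = inj₂ refl

    embed-⊏⁺ : ∀ {a b} → a ⊏ b → embed′ a ⊏ embed′ b
    embed-⊏⁺ below-root      = below-root
    embed-⊏⁺ (below-sub p⊏q) = below-sub (branch-⊏⁺ _ p⊏q)

    embed-⊏⁻ : ∀ {a b} → embed′ a ⊏ embed′ b → a ⊏ b
    embed-⊏⁻ {sub j p} {root}     _ = below-root
    embed-⊏⁻ {sub j p} {sub j′ q} r with below-sub-index r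
    ... | refl = below-sub (branch-⊏⁻ j (below-sub⁻¹ r))

    leaf-⊏⁺ : ∀ {b} → sub i v ⊑ b → leaf′ ⊏ embed′ b
    leaf-⊏⁺ (inj₁ refl)            = below-sub (leaf-⊏-branch⁺ (inj₁ refl))
    leaf-⊏⁺ (inj₂ below-root)      = below-root
    leaf-⊏⁺ (inj₂ (below-sub v⊏q)) = below-sub (leaf-⊏-branch⁺ (inj₂ v⊏q))

    leaf-⊏⁻ : ∀ {b} → leaf′ ⊏ embed′ b → sub i v ⊑ b
    leaf-⊏⁻ {root}    _ = inj₂ below-root
    leaf-⊏⁻ {sub j q} r with below-sub-index r
    ... | refl with leaf-⊏-branch⁻ (below-sub⁻¹ r)
    ...   | inj₁ refl = inj₁ refl
    ...   | inj₂ v⊏q  = inj₂ (below-sub v⊏q)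

    leaf-terminal : ∀ {x} → ¬ x ⊏ leaf′
    leaf-terminal (below-sub y⊏leaf) = E.leaf-terminal y⊏leaf

upd-same : ∀ {k} (f : Fin k → Tree) i {t} → upd f i t i ≡ t
upd-same f i with i ≟ i
... | yes _  = refl
... | no i≢i = contradiction refl i≢i

upd-other : ∀ {k} (f : Fin k → Tree) {i j t} → j ≢ i → upd f i t j ≡ f j
upd-other f {i} {j} j≢i with j ≟ i
... | yes j≡i = contradiction j≡i j≢i
... | no _    = refl

snoc-punchIn : ∀ {k} (f : Fin k → Tree) i → f i ≡ snoc f (punchIn (fromℕ k) i)
snoc-punchIn {suc k} f zero    = refl
snoc-punchIn {suc k} f (suc i) = snoc-punchIn (f ∘ suc) i

snoc-fromℕ : ∀ {k} (f : Fin k → Tree) → snoc f (fromℕ k) ≡ •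
snoc-fromℕ {zero}  f = refl
snoc-fromℕ {suc k} f = snoc-fromℕ (f ∘ suc)

edgeless-• : Edgeless •
edgeless-• {sub () _}

graft-⊲ : ∀ t v → t ⊲[ v ] graft t v
graft-⊲ (node k f) root =
  leafChild-⊲ (fromℕ k) (snoc-punchIn f) (subst Edgeless (sym (snoc-fromℕ f)) edgeless-•)
graft-⊲ (node k f) (sub i p) =
  branch-⊲ i (λ j j≢i → sym (upd-other f j≢i))
    (subst (f i ⊲[ p ]_) (sym (upd-same f i)) (graft-⊲ (f i) p))

⊲-substˡ : ∀ {s s′ v t} (s≡s′ : s ≡ s′) (E : s ⊲[ v ] t) →
           Σ (s′ ⊲[ subst Pos s≡s′ v ] t) λ E′ → leaf E′ ≡ leaf E
⊲-substˡ refl E = E , refl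

removeIn-cases : ∀ s p {rebuild del t′} → removeIn s p rebuild del ≡ just t′ →
                 (Edgeless s × del ≡ t′) ⊎
                 (∃ λ s′ → removeLeaf s p ≡ just s′ × rebuild s′ ≡ t′)
removeIn-cases (node zero g) root refl = inj₁ ((λ { {sub () _} }) , refl)
removeIn-cases (node (suc k) g) (sub j q) e with removeLeaf (node (suc k) g) (sub j q) | e
... | just s′ | refl = inj₂ (s′ , refl , refl)

removeLeaf-⊲ : ∀ t w {s} → removeLeaf t w ≡ just s →
               ∃ λ v → Σ (s ⊲[ v ] t) λ E → leaf E ≡ w
removeLeaf-⊲ (node (suc k) f) (sub i p) e with removeIn-cases (f i) p e
... | inj₁ (edgeless , refl) =
  root , leafChild-⊲ i (λ _ → refl) edgeless , cong (sub i) (edgeless-rootOf edgeless p)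
... | inj₂ (s′ , e′ , refl) with removeLeaf-⊲ (f i) p e′
...   | v , E , leaf≡p with ⊲-substˡ (sym (upd-same f i)) E
...     | E′ , leaf≡ =
  _ , branch-⊲ i (λ j j≢i → upd-other f j≢i) E′ , cong (sub i) (trans leaf≡ leaf≡p)

mutual
  removeLeaf-total : ∀ t w → w ≢ rootOf t → (∀ {x} → ¬ x ⊏ w) →
                     ∃ λ s → removeLeaf t w ≡ just s
  removeLeaf-total (node k f)       root      w≢root _ = contradiction refl w≢root
  removeLeaf-total (node (suc k) f) (sub i p) _ terminal = removeIn-total (f i) p (terminal ∘ below-sub)

  removeIn-total : ∀ s p {rebuild del} → (∀ {x} → ¬ x ⊏ p) →
                   ∃ λ t′ → removeIn s p rebuild del ≡ just t′
  removeIn-total (node zero g)    root _ = _ , refl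
  removeIn-total (node (suc m) g) root terminal =
    ⊥-elim (terminal (below-root {i = zero} {p = rootOf (g zero)}))
  removeIn-total (node (suc m) g) (sub j q) {rebuild} terminal
    with removeLeaf-total (node (suc m) g) (sub j q) (λ ()) terminal
  ... | s′ , e = rebuild s′ , cong (Data.Maybe.map rebuild) e

inject₁-< : ∀ {n} {a b : Fin n} → a <ᶠ b → inject₁ a <ᶠ inject₁ b
inject₁-< {a = a} {b} = subst₂ ℕ._<_ (sym (Fin.toℕ-inject₁ a)) (sym (Fin.toℕ-inject₁ b))

inject₁<fromℕ : ∀ {n} (a : Fin n) → inject₁ a <ᶠ fromℕ n
inject₁<fromℕ {n} a = subst (Fin.toℕ (inject₁ a) ℕ.<_) (sym (Fin.toℕ-fromℕ n)) (Fin.inject₁ℕ< a)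

fromℕ≮ : ∀ {n} (a : Fin (suc n)) → ¬ fromℕ n <ᶠ a
fromℕ≮ a top<a = ℕ.<⇒≱ top<a (Fin.≤fromℕ a)

lower : ∀ {n} (a : Fin (suc n)) → a ≢ fromℕ n → Fin n
lower {n} a a≢top =
  Fin.lower₁ a (λ n≡a → a≢top (Fin.toℕ-injective (trans (sym n≡a) (sym (Fin.toℕ-fromℕ n)))))

inject₁-lower : ∀ {n} (a : Fin (suc n)) (a≢top : a ≢ fromℕ n) → inject₁ (lower a a≢top) ≡ a
inject₁-lower a _ = Fin.inject₁-lower₁ a _

-- Labellings of t by Fin n for arbitrary n, so that the number of labels can shrink with the tree;
-- Labelling t is the case n = size t.
record Lab (t : Tree) (n : ℕ) : Set where
  field
    label            : Pos t → Fin n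
    vertex           : Fin n → Pos t
    label-vertex     : ∀ a → label (vertex a) ≡ a
    vertex-label     : ∀ x → vertex (label x) ≡ x
    label-decreasing : ∀ {x y} → x ⊏ y → label y <ᶠ label x

open Lab

infix 4 _≋_

_≋_ : ∀ {t n} → Lab t n → Lab t n → Set
g ≋ h = ∀ x → label g x ≡ label h x

label-injective : ∀ {t n} (g : Lab t n) {x y} → label g x ≡ label g y → x ≡ y
label-injective g {x} {y} e =
  trans (sym (vertex-label g x)) (trans (cong (vertex g) e) (vertex-label g y))

vertex-injective : ∀ {t n} (g : Lab t n) {a b} → vertex g a ≡ vertex g b → a ≡ b
vertex-injective g {a} {b} e =
  trans (sym (label-vertex g a)) (trans (cong (label g) e) (label-vertex g b))

vertex-≋ : ∀ {t n} {g h : Lab t n} → g ≋ h → ∀ a → vertex g a ≡ vertex h a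
vertex-≋ {g = g} {h} g≋h a =
  label-injective g (trans (label-vertex g a) (sym (trans (g≋h (vertex h a)) (label-vertex h a))))

label-rootOf : ∀ {t n} (g : Lab t (suc n)) → label g (rootOf t) ≡ zero
label-rootOf g with ⊑-rootOf (vertex g zero)
... | inj₁ v≡root = trans (cong (label g) (sym v≡root)) (label-vertex g zero)
... | inj₂ v⊏root =
  contradiction (subst (label g (rootOf _) <ᶠ_) (label-vertex g zero) (label-decreasing g v⊏root)) ℕ.n≮0

top : ∀ {t n} → Lab t (suc n) → Pos t
top {n = n} g = vertex g (fromℕ n)

top-terminal : ∀ {t n} (g : Lab t (suc n)) {x} → ¬ x ⊏ top g
top-terminal {n = n} g x⊏top =
  fromℕ≮ (label g _) (subst (_<ᶠ label g _) (label-vertex g (fromℕ n)) (label-decreasing g x⊏top))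

module _ {s v t} (E : s ⊲[ v ] t) where
  private module E = _⊲[_]_ E

  module _ {n} (g : Lab s n) where

    extend-label : Pos t → Fin (suc n)
    extend-label x with E.embed-or-leaf x
    ... | inj₁ (a , _) = inject₁ (label g a)
    ... | inj₂ _       = fromℕ n

    extend-vertex : Fin (suc n) → Pos t
    extend-vertex a with view a
    ... | ‵fromℕ     = E.leaf
    ... | ‵inject₁ b = E.embed (vertex g b)

    extend-label-embed : ∀ a → extend-label (E.embed a) ≡ inject₁ (label g a)
    extend-label-embed a with E.embed-or-leaf (E.embed a)
    ... | inj₁ (a′ , e) = cong (inject₁ ∘ label g) (E.embed-injective e)
    ... | inj₂ e        = contradiction (sym e) (E.embed≢leaf a)

    extend-label-leaf : extend-label E.leaf ≡ fromℕ n
    extend-label-leaf with E.embed-or-leaf E.leaf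
    ... | inj₁ (a , e) = contradiction e (E.embed≢leaf a)
    ... | inj₂ _       = refl

    extend-vertex-inject₁ : ∀ b → extend-vertex (inject₁ b) ≡ E.embed (vertex g b)
    extend-vertex-inject₁ b rewrite view-inject₁ b = refl

    extend-vertex-fromℕ : extend-vertex (fromℕ n) ≡ E.leaf
    extend-vertex-fromℕ rewrite view-fromℕ n = refl

    extend : Lab t (suc n)
    extend = record
      { label = extend-label ; vertex = extend-vertex
      ; label-vertex = label-vertex′ ; vertex-label = vertex-label′
      ; label-decreasing = label-decreasing′ }
      where
      label-vertex′ : ∀ a → extend-label (extend-vertex a) ≡ a
      label-vertex′ a with view a
      ... | ‵fromℕ     = extend-label-leaf
      ... | ‵inject₁ b = trans (extend-label-embed _) (cong inject₁ (label-vertex g b))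

      vertex-label′ : ∀ x → extend-vertex (extend-label x) ≡ x
      vertex-label′ x with E.embed-or-leaf x
      ... | inj₁ (a , refl) = trans (extend-vertex-inject₁ _) (cong E.embed (vertex-label g a))
      ... | inj₂ refl       = extend-vertex-fromℕ

      label-decreasing′ : ∀ {x y} → x ⊏ y → extend-label y <ᶠ extend-label x
      label-decreasing′ {x} {y} x⊏y with E.embed-or-leaf x | E.embed-or-leaf y
      ... | inj₁ (a , refl) | inj₁ (b , refl) = inject₁-< (label-decreasing g (E.embed-⊏⁻ x⊏y))
      ... | inj₂ refl       | inj₁ (b , refl) = inject₁<fromℕ _
      ... | _               | inj₂ refl       = contradiction x⊏y E.leaf-terminal

  extend-cong : ∀ {n} {g h : Lab s n} → g ≋ h → extend g ≋ extend h
  extend-cong {g = g} {h} g≋h x with E.embed-or-leaf x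
  ... | inj₁ (a , refl) = cong inject₁ (g≋h a)
  ... | inj₂ refl       = refl

  module _ {n} (h : Lab t (suc n)) (top≡leaf : top h ≡ E.leaf) where

    private
      label-embed≢top : ∀ a → label h (E.embed a) ≢ fromℕ n
      label-embed≢top a e =
        E.embed≢leaf a (trans (sym (vertex-label h _)) (trans (cong (vertex h) e) top≡leaf))

      vertex-inject₁ : ∀ b → ∃ λ a → E.embed a ≡ vertex h (inject₁ b)
      vertex-inject₁ b with E.embed-or-leaf (vertex h (inject₁ b))
      ... | inj₁ found = found
      ... | inj₂ leaf≡ = contradiction (vertex-injective h (trans top≡leaf leaf≡)) Fin.fromℕ≢inject₁

    restrict-label : Pos s → Fin n
    restrict-label a = lower (label h (E.embed a)) (label-embed≢top a)

    inject₁-restrict-label : ∀ a → inject₁ (restrict-label a) ≡ label h (E.embed a)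
    inject₁-restrict-label a = inject₁-lower _ (label-embed≢top a)

    restrict : Lab s n
    restrict = record
      { label = restrict-label ; vertex = proj₁ ∘ vertex-inject₁
      ; label-vertex = label-vertex′ ; vertex-label = vertex-label′
      ; label-decreasing = label-decreasing′ }
      where
      label-vertex′ : ∀ b → restrict-label (proj₁ (vertex-inject₁ b)) ≡ b
      label-vertex′ b = Fin.inject₁-injective (begin
        inject₁ (restrict-label _)      ≡⟨ inject₁-restrict-label _ ⟩
        label h (E.embed _)             ≡⟨ cong (label h) (proj₂ (vertex-inject₁ b)) ⟩
        label h (vertex h (inject₁ b))  ≡⟨ label-vertex h (inject₁ b) ⟩
        inject₁ b                       ∎)
        where open ≡-Reasoning

      vertex-label′ : ∀ a → proj₁ (vertex-inject₁ (restrict-label a)) ≡ a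
      vertex-label′ a = E.embed-injective (begin
        E.embed _                              ≡⟨ proj₂ (vertex-inject₁ _) ⟩
        vertex h (inject₁ (restrict-label a))  ≡⟨ cong (vertex h) (inject₁-restrict-label a) ⟩
        vertex h (label h (E.embed a))         ≡⟨ vertex-label h _ ⟩
        E.embed a                              ∎)
        where open ≡-Reasoning

      label-decreasing′ : ∀ {a b} → a ⊏ b → restrict-label b <ᶠ restrict-label a
      label-decreasing′ {a} {b} a⊏b =
        subst₂ ℕ._<_ (Fin.toℕ-inject₁ (restrict-label b)) (Fin.toℕ-inject₁ (restrict-label a))
          (subst₂ _<ᶠ_ (sym (inject₁-restrict-label b)) (sym (inject₁-restrict-label a))
            (label-decreasing h (E.embed-⊏⁺ a⊏b)))

  restrict-cong : ∀ {n} {h h′ : Lab t (suc n)} (e : top h ≡ E.leaf) (e′ : top h′ ≡ E.leaf) →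
                  h ≋ h′ → restrict h e ≋ restrict h′ e′
  restrict-cong {h = h} {h′} e e′ h≋h′ a = Fin.inject₁-injective (begin
    inject₁ (restrict-label h e a)    ≡⟨ inject₁-restrict-label h e a ⟩
    label h (E.embed a)               ≡⟨ h≋h′ (E.embed a) ⟩
    label h′ (E.embed a)              ≡⟨ inject₁-restrict-label h′ e′ a ⟨
    inject₁ (restrict-label h′ e′ a)  ∎)
    where open ≡-Reasoning

  extend-top : ∀ {n} (g : Lab s n) → top (extend g) ≡ E.leaf
  extend-top g = extend-vertex-fromℕ g

  restrict-extend : ∀ {n} (g : Lab s n) → restrict (extend g) (extend-top g) ≋ g
  restrict-extend g a = Fin.inject₁-injective
    (trans (inject₁-restrict-label (extend g) (extend-top g) a) (extend-label-embed g a))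

  extend-restrict : ∀ {n} (h : Lab t (suc n)) (e : top h ≡ E.leaf) → extend (restrict h e) ≋ h
  extend-restrict {n} h e x with E.embed-or-leaf x
  ... | inj₁ (a , refl) = inject₁-restrict-label h e a
  ... | inj₂ refl       = sym (trans (cong (label h) (sym e)) (label-vertex h (fromℕ n)))

-- Counting equivalence classes

HasCard-transport : ∀ {A B : Set} {_≈ᴬ_ : A → A → Set} {_≈ᴮ_ : B → B → Set} {n} →
                    IsEquivalence _≈ᴮ_ → (to : A → B) →
                    (∀ {a a′} → a ≈ᴬ a′ → to a ≈ᴮ to a′) →
                    (∀ {a a′} → to a ≈ᴮ to a′ → a ≈ᴬ a′) →
                    (∀ b → ∃ λ a → to a ≈ᴮ b) → HasCard B _≈ᴮ_ n → HasCard A _≈ᴬ_ n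
HasCard-transport {A} {_≈ᴬ_ = _≈ᴬ_} {_≈ᴮ_} {n} ≈ᴮ-equiv to to-cong to-reflect to-surjective
                  (e , e-injective , e-surjective) = e′ , injective , surjective
  where
  open IsEquivalence ≈ᴮ-equiv using () renaming (sym to ≈ᴮ-sym; trans to ≈ᴮ-trans)
  e′ : Fin n → A
  e′ = proj₁ ∘ to-surjective ∘ e
  to-e′ : ∀ i → to (e′ i) ≈ᴮ e i
  to-e′ = proj₂ ∘ to-surjective ∘ e
  injective : ∀ i j → e′ i ≈ᴬ e′ j → i ≡ j
  injective i j e′i≈e′j =
    e-injective i j (≈ᴮ-trans (≈ᴮ-sym (to-e′ i)) (≈ᴮ-trans (to-cong e′i≈e′j) (to-e′ j)))
  surjective : ∀ a → ∃ λ i → e′ i ≈ᴬ a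
  surjective a = let i , ei≈a = e-surjective (to a) in i , to-reflect (≈ᴮ-trans (to-e′ i) ei≈a)

HasCard-⊥ : ∀ {A : Set} {_≈_ : A → A → Set} → ¬ A → HasCard A _≈_ 0
HasCard-⊥ ¬a = (λ ()) , (λ ()) , (λ a → contradiction a ¬a)

HasCard-⊎ : ∀ {A B : Set} {_≈ᴬ_ : A → A → Set} {_≈ᴮ_ : B → B → Set} {m n} →
            HasCard A _≈ᴬ_ m → HasCard B _≈ᴮ_ n →
            HasCard (A ⊎ B) (Pointwise _≈ᴬ_ _≈ᴮ_) (m + n)
HasCard-⊎ {_≈ᴬ_ = _≈ᴬ_} {_≈ᴮ_} {m} {n} (eᴬ , eᴬ-injective , eᴬ-surjective)
          (eᴮ , eᴮ-injective , eᴮ-surjective) = e ∘ Fin.splitAt m , injective , surjective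
  where
  e : Fin m ⊎ Fin n → _
  e = Data.Sum.map eᴬ eᴮ
  e-injective : ∀ i j → Pointwise _≈ᴬ_ _≈ᴮ_ (e i) (e j) → i ≡ j
  e-injective (inj₁ i) (inj₁ j) (inj₁ ei≈ej) = cong inj₁ (eᴬ-injective i j ei≈ej)
  e-injective (inj₂ i) (inj₂ j) (inj₂ ei≈ej) = cong inj₂ (eᴮ-injective i j ei≈ej)
  injective : ∀ i j → Pointwise _≈ᴬ_ _≈ᴮ_ (e (Fin.splitAt m i)) (e (Fin.splitAt m j)) → i ≡ j
  injective i j ei≈ej = begin
    i                               ≡⟨ Fin.join-splitAt m n i ⟨
    Fin.join m n (Fin.splitAt m i)  ≡⟨ cong (Fin.join m n) splitAt-i≡j ⟩
    Fin.join m n (Fin.splitAt m j)  ≡⟨ Fin.join-splitAt m n j ⟩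
    j                               ∎
    where
    open ≡-Reasoning
    splitAt-i≡j : Fin.splitAt m i ≡ Fin.splitAt m j
    splitAt-i≡j = e-injective (Fin.splitAt m i) (Fin.splitAt m j) ei≈ej
  surjective : ∀ x → ∃ λ i → Pointwise _≈ᴬ_ _≈ᴮ_ (e (Fin.splitAt m i)) x
  surjective (inj₁ a) = let i , ei≈a = eᴬ-surjective a in
    i Fin.↑ˡ n , subst (λ y → Pointwise _≈ᴬ_ _≈ᴮ_ (e y) (inj₁ a)) (sym (Fin.splitAt-↑ˡ m i n))
                       (inj₁ ei≈a)
  surjective (inj₂ b) = let i , ei≈b = eᴮ-surjective b in
    m Fin.↑ʳ i , subst (λ y → Pointwise _≈ᴬ_ _≈ᴮ_ (e y) (inj₂ b)) (sym (Fin.splitAt-↑ʳ m n i))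
                       (inj₂ ei≈b)

module _ {A X : Set} {_≈_ : A → A → Set} (≈-equiv : IsEquivalence _≈_)
         (f : A → X) (f-cong : ∀ {a a′} → a ≈ a′ → f a ≡ f a′) where

  HasCard-fibers : (c : X → ℕ) → (∀ w → HasCard (Σ A λ a → f a ≡ w) (_≈_ on proj₁) (c w)) →
                   (ws : List X) → Unique ws → (∀ w → w ∈ ws) → HasCard A _≈_ (sum (map c ws))
  HasCard-fibers c fibers ws ws! ∈ws =
    HasCard-transport ≈₁-equiv (λ a → a , ∈ws (f a)) id id (λ (a , _) → a , ≈-refl) (over ws ws!)
    where
    open IsEquivalence ≈-equiv using () renaming (refl to ≈-refl; sym to ≈-sym)
    _≈₁_ : ∀ {P : A → Set} → Σ A P → Σ A P → Set
    _≈₁_ = _≈_ on proj₁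
    ≈₁-equiv : ∀ {P : A → Set} → IsEquivalence (_≈₁_ {P})
    ≈₁-equiv = On.isEquivalence proj₁ ≈-equiv
    over : ∀ ws → Unique ws → HasCard (Σ A λ a → f a ∈ ws) _≈₁_ (sum (map c ws))
    over []       _          = HasCard-⊥ {_≈_ = _≈₁_} λ ()
    over (w ∷ ws) (w∉ws ∷ ws!) =
      HasCard-transport (⊎-isEquivalence ≈₁-equiv ≈₁-equiv)
                        split split-cong split-reflect split-surjective
                        (HasCard-⊎ (fibers w) (over ws ws!))
      where
      split : Σ A (λ a → f a ∈ w ∷ ws) → Σ A (λ a → f a ≡ w) ⊎ Σ A (λ a → f a ∈ ws)
      split (a , here fa≡w)   = inj₁ (a , fa≡w)
      split (a , there fa∈ws) = inj₂ (a , fa∈ws)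
      split-cong : ∀ {x y} → x ≈₁ y → Pointwise _≈₁_ _≈₁_ (split x) (split y)
      split-cong {_ , here _}    {_ , here _}    a≈b = inj₁ a≈b
      split-cong {_ , there _}   {_ , there _}   a≈b = inj₂ a≈b
      split-cong {_ , here fa≡w} {_ , there fb∈} a≈b =
        contradiction (trans (sym fa≡w) (f-cong a≈b)) (All.lookup w∉ws fb∈)
      split-cong {_ , there fa∈} {_ , here fb≡w} a≈b =
        contradiction (trans (sym fb≡w) (f-cong (≈-sym a≈b))) (All.lookup w∉ws fa∈)
      split-reflect : ∀ {x y} → Pointwise _≈₁_ _≈₁_ (split x) (split y) → x ≈₁ y
      split-reflect {_ , here _}  {_ , here _}  (inj₁ a≈b) = a≈b
      split-reflect {_ , there _} {_ , there _} (inj₂ a≈b) = a≈b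
      split-surjective : ∀ y → ∃ λ x → Pointwise _≈₁_ _≈₁_ (split x) y
      split-surjective (inj₁ (a , fa≡w))  = (a , here fa≡w) , inj₁ ≈-refl
      split-surjective (inj₂ (a , fa∈ws)) = (a , there fa∈ws) , inj₂ ≈-refl

lookup-injective : ∀ {A : Set} {xs : List A} → Unique xs →
                   ∀ {i j} → lookup xs i ≡ lookup xs j → i ≡ j
lookup-injective {xs = _ ∷ _} (x∉ ∷ _)   {zero}  {zero}  _ = refl
lookup-injective {xs = _ ∷ _} (x∉ ∷ _)   {zero}  {suc j} e = contradiction e (All.lookup x∉ (∈.∈-lookup j))
lookup-injective {xs = _ ∷ _} (x∉ ∷ _)   {suc i} {zero}  e = contradiction (sym e) (All.lookup x∉ (∈.∈-lookup i))
lookup-injective {xs = _ ∷ _} (_ ∷ xs!) {suc i} {suc j} e = cong suc (lookup-injective xs! e)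

HasCard-filter : ∀ {X : Set} {P : X → Set} (P? : ∀ x → Dec (P x)) {xs} → Unique xs →
                 (∀ x → x ∈ xs) → HasCard (Σ X P) (_≡_ on proj₁) (length (filter P? xs))
HasCard-filter {X} P? {xs} xs! ∈xs =
  (λ κ → lookup ys κ , proj₂ (∈.∈-filter⁻ P? {xs = xs} (∈.∈-lookup κ))) ,
  (λ κ κ′ → lookup-injective (Unique.filter⁺ P? xs!)) ,
  (λ (x , px) → let x∈ys = ∈.∈-filter⁺ P? {xs = xs} (∈xs x) px in
                index x∈ys , sym (Any.lookup-index x∈ys))
  where
  ys : List X
  ys = filter P? xs

-- Labellings are counted by iterated leaf deletion

≋-isEquivalence : ∀ {t n} → IsEquivalence (_≋_ {t} {n})
≋-isEquivalence = record
  { refl  = λ _ → refl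
  ; sym   = λ g≋h x → sym (g≋h x)
  ; trans = λ g≋h h≋i x → trans (g≋h x) (h≋i x) }

top-≋ : ∀ {t n} {g h : Lab t (suc n)} → g ≋ h → top g ≡ top h
top-≋ {n = n} {g} {h} g≋h = vertex-≋ {g = g} {h} g≋h (fromℕ n)

top-removable : ∀ {t n} (h : Lab t (suc (suc n))) → ∃ λ s → removeLeaf t (top h) ≡ just s
top-removable {t} {n} h = removeLeaf-total t (top h) top≢root (top-terminal h)
  where
  top≢root : top h ≢ rootOf t
  top≢root top≡root with trans (sym (label-vertex h (fromℕ (suc n))))
                                (trans (cong (label h) top≡root) (label-rootOf h))
  ... | ()

restrict-injective : ∀ {s v t n} (E : s ⊲[ v ] t) {h h′ : Lab t (suc n)}
                     (e : top h ≡ leaf E) (e′ : top h′ ≡ leaf E) →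
                     restrict E h e ≋ restrict E h′ e′ → h ≋ h′
restrict-injective E {h} {h′} e e′ r≋r′ x =
  trans (sym (extend-restrict E h e x)) (trans (extend-cong E r≋r′ x) (extend-restrict E h′ e′ x))

HasCard-top≡leaf : ∀ {s v t n c} (E : s ⊲[ v ] t) → HasCard (Lab s n) _≋_ c →
                   HasCard (Σ (Lab t (suc n)) λ h → top h ≡ leaf E) (_≋_ on proj₁) c
HasCard-top≡leaf E = HasCard-transport ≋-isEquivalence
  (λ (h , e) → restrict E h e) (λ {(h , e)} {(h′ , e′)} → restrict-cong E {h = h} {h′} e e′)
  (λ {(h , e)} {(h′ , e′)} → restrict-injective E {h} {h′} e e′)
  (λ g → (extend E g , extend-top E g) , restrict-extend E g)

iter-suc : ∀ {A : Set} n (g : A → A) a → iter (suc n) g a ≡ iter n g (g a)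
iter-suc zero    g a = refl
iter-suc (suc n) g a = cong g (iter-suc n g a)

iter-𝔓*-[] : ∀ m → iter m 𝔓* [] ≡ []
iter-𝔓*-[] zero    = refl
iter-𝔓*-[] (suc m) = cong 𝔓* (iter-𝔓*-[] m)

iter-𝔓*-++ : ∀ m xs ys → iter m 𝔓* (xs ++ ys) ≡ iter m 𝔓* xs ++ iter m 𝔓* ys
iter-𝔓*-++ zero    xs ys = refl
iter-𝔓*-++ (suc m) xs ys =
  trans (cong 𝔓* (iter-𝔓*-++ m xs ys)) (List.concatMap-++ 𝔓 (iter m 𝔓* xs) (iter m 𝔓* ys))

length-iter-𝔓* : ∀ m xs →
                 length (iter m 𝔓* xs) ≡ sum (map (λ x → length (iter m 𝔓* (x ∷ []))) xs)
length-iter-𝔓* m []       = cong length (iter-𝔓*-[] m)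
length-iter-𝔓* m (x ∷ xs) = begin
  length (iter m 𝔓* ((x ∷ []) ++ xs))                   ≡⟨ cong length (iter-𝔓*-++ m (x ∷ []) xs) ⟩
  length (iter m 𝔓* (x ∷ []) ++ iter m 𝔓* xs)           ≡⟨ List.length-++ (iter m 𝔓* (x ∷ [])) ⟩
  length (iter m 𝔓* (x ∷ [])) + length (iter m 𝔓* xs)  ≡⟨ cong (_ +_) (length-iter-𝔓* m xs) ⟩
  _                                                     ∎
  where open ≡-Reasoning

sum-map-mapMaybe : ∀ {A B : Set} (g : B → ℕ) (h : A → Maybe B) xs →
                   sum (map g (mapMaybe h xs)) ≡ sum (map (maybe g 0 ∘ h) xs)
sum-map-mapMaybe g h []       = refl
sum-map-mapMaybe g h (x ∷ xs) with h x
... | just y  = cong (g y +_) (sum-map-mapMaybe g h xs)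
... | nothing = sum-map-mapMaybe g h xs

deletionsAt : ℕ → (t : Tree) → Pos t → ℕ
deletionsAt m t w = maybe (λ s → length (iter m 𝔓* (s ∷ []))) 0 (removeLeaf t w)

length-iter-𝔓-suc : ∀ m t →
                    length (iter (suc m) 𝔓* (t ∷ [])) ≡ sum (map (deletionsAt m t) (vertices t))
length-iter-𝔓-suc m t = begin
  length (iter (suc m) 𝔓* (t ∷ []))   ≡⟨ cong length (iter-suc m 𝔓* (t ∷ [])) ⟩
  length (iter m 𝔓* (𝔓 t ++ []))      ≡⟨ cong (length ∘ iter m 𝔓*) (List.++-identityʳ (𝔓 t)) ⟩
  length (iter m 𝔓* (𝔓 t))            ≡⟨ length-iter-𝔓* m (𝔓 t) ⟩
  sum (map (λ s → length (iter m 𝔓* (s ∷ []))) (mapMaybe (removeLeaf t) (vertices t)))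
                                      ≡⟨ sum-map-mapMaybe _ (removeLeaf t) (vertices t) ⟩
  sum (map (deletionsAt m t) (vertices t)) ∎
  where open ≡-Reasoning

childless-lab : ∀ {f} → Lab (node 0 f) 1
childless-lab = record
  { label = λ _ → zero ; vertex = λ _ → root ; label-vertex = λ { zero → refl }
  ; vertex-label = λ { root → refl } ; label-decreasing = λ { (below-root {i = ()}) } }

size≢0 : ∀ t → size t ≢ 0
size≢0 (node k f) ()

size≡1⇒childless : ∀ {k f} → size (node k f) ≡ 1 → k ≡ 0
size≡1⇒childless {zero}      _      = refl
size≡1⇒childless {suc k} {f} size≡1 =
  contradiction (ℕ.m+n≡0⇒m≡0 (size (f zero)) (ℕ.suc-injective size≡1)) (size≢0 (f zero))

Lab-count : ∀ m t → size t ≡ suc m → HasCard (Lab t (suc m)) _≋_ (length (iter m 𝔓* (t ∷ [])))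
Lab-count zero (node k f) size≡1 with size≡1⇒childless {k} {f} size≡1
... | refl = (λ _ → childless-lab) , (λ { zero zero _ → refl }) , (λ g → zero , λ x → Fin1-unique _ _)
  where
  Fin1-unique : (a b : Fin 1) → a ≡ b
  Fin1-unique zero zero = refl
Lab-count (suc m) t size≡ =
  subst (HasCard (Lab t (suc (suc m))) _≋_) (sym (length-iter-𝔓-suc m t))
    (HasCard-fibers ≋-isEquivalence top (λ {g} {h} → top-≋ {g = g} {h}) (deletionsAt m t) fiber
                    (vertices t) (vertices-unique t) vertices-complete)
  where
  fiber : ∀ w → HasCard (Σ (Lab t (suc (suc m))) λ h → top h ≡ w) (_≋_ on proj₁)
                        (deletionsAt m t w)
  fiber w with removeLeaf t w in removed
  ... | nothing = HasCard-⊥ {_≈_ = _≋_ on proj₁} λ { (h , refl) →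
    case trans (sym removed) (proj₂ (top-removable h)) of λ () }
  ... | just s with removeLeaf-⊲ t w removed
  ...   | _ , E , refl =
    HasCard-top≡leaf E (Lab-count m s (ℕ.suc-injective (trans (sym (size-⊲ E)) size≡)))

-- The order induced on labels

infix 4 _⊏⟨_⟩_ _⊑⟨_⟩_

_⊏⟨_⟩_ : ∀ {t n} → Fin n → Lab t n → Fin n → Set
a ⊏⟨ g ⟩ b = vertex g a ⊏ vertex g b

_⊑⟨_⟩_ : ∀ {t n} → Fin n → Lab t n → Fin n → Set
a ⊑⟨ g ⟩ b = vertex g a ⊑ vertex g b

record SameOrder {s t n} (g : Lab s n) (h : Lab t n) : Set where
  constructor same-order
  field ⊏-⇔ : ∀ a b → a ⊏⟨ g ⟩ b ⇔ a ⊏⟨ h ⟩ b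

open SameOrder

SameOrder-sym : ∀ {s t n} {g : Lab s n} {h : Lab t n} → SameOrder g h → SameOrder h g
SameOrder-sym g∼h = same-order λ a b → ⇔.sym (⊏-⇔ g∼h a b)

SameOrder-trans : ∀ {s t u n} {g : Lab s n} {h : Lab t n} {i : Lab u n} →
                  SameOrder g h → SameOrder h i → SameOrder g i
SameOrder-trans g∼h h∼i = same-order λ a b → ⇔.trans (⊏-⇔ g∼h a b) (⊏-⇔ h∼i a b)

≋⇒SameOrder : ∀ {t n} {g h : Lab t n} → g ≋ h → SameOrder g h
≋⇒SameOrder {g = g} {h} g≋h = same-order same-vertices
  where
  same-vertices : ∀ a b → a ⊏⟨ g ⟩ b ⇔ a ⊏⟨ h ⟩ b
  same-vertices a b rewrite vertex-≋ {g = g} {h} g≋h a | vertex-≋ {g = g} {h} g≋h b = ⇔.refl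

SameOrder? : ∀ {s t n} (g : Lab s n) (h : Lab t n) → Dec (SameOrder g h)
SameOrder? g h = Dec.map′ same-order ⊏-⇔ (Fin.all? λ a → Fin.all? λ b →
  Dec.map′ (λ (to , from) → mk⇔ to from) (λ g⇔h → Equivalence.to g⇔h , Equivalence.from g⇔h)
           ((vertex g a ⊏? vertex g b →-dec vertex h a ⊏? vertex h b) ×-dec
            (vertex h a ⊏? vertex h b →-dec vertex g a ⊏? vertex g b)))

SameOrder-⊑ : ∀ {s t n} {g : Lab s n} {h : Lab t n} → SameOrder g h →
              ∀ {a b} → a ⊑⟨ g ⟩ b → a ⊑⟨ h ⟩ b
SameOrder-⊑ {g = g} {h} g∼h (inj₁ e)   = inj₁ (cong (vertex h) (vertex-injective g e))
SameOrder-⊑ g∼h {a} {b} (inj₂ a⊏b) = inj₂ (Equivalence.to (⊏-⇔ g∼h a b) a⊏b)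

module _ {s v t} (E : s ⊲[ v ] t) {n} (g : Lab s n) where
  private module E = _⊲[_]_ E

  extend-⊏-inject₁ : ∀ a b → inject₁ a ⊏⟨ extend E g ⟩ inject₁ b ⇔ a ⊏⟨ g ⟩ b
  extend-⊏-inject₁ a b rewrite extend-vertex-inject₁ E g a | extend-vertex-inject₁ E g b =
    mk⇔ E.embed-⊏⁻ E.embed-⊏⁺

  extend-fromℕ-⊏ : ∀ b → fromℕ n ⊏⟨ extend E g ⟩ inject₁ b ⇔ v ⊑ vertex g b
  extend-fromℕ-⊏ b rewrite extend-vertex-fromℕ E g | extend-vertex-inject₁ E g b =
    mk⇔ E.leaf-⊏⁻ E.leaf-⊏⁺

  extend-⊄-fromℕ : ∀ a → ¬ a ⊏⟨ extend E g ⟩ fromℕ n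
  extend-⊄-fromℕ a rewrite extend-vertex-fromℕ E g = E.leaf-terminal

SameOrder-up-set⇔label : ∀ {s t n} {g : Lab s n} {h : Lab t n} → SameOrder g h → ∀ {x y} →
                (∀ b → x ⊑ vertex g b ⇔ y ⊑ vertex h b) ⇔ label g x ≡ label h y
SameOrder-up-set⇔label {g = g} {h} g∼h {x} {y} = mk⇔ same-label same-up-sets
  where
  g⊑⇒h⊑ : ∀ {a b} → a ⊑⟨ g ⟩ b → a ⊑⟨ h ⟩ b
  g⊑⇒h⊑ = SameOrder-⊑ g∼h
  h⊑⇒g⊑ : ∀ {a b} → a ⊑⟨ h ⟩ b → a ⊑⟨ g ⟩ b
  h⊑⇒g⊑ = SameOrder-⊑ (SameOrder-sym g∼h)

  same-up-sets : label g x ≡ label h y → ∀ b → x ⊑ vertex g b ⇔ y ⊑ vertex h b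
  same-up-sets gx≡hy b =
    subst₂ (λ x′ y′ → x′ ⊑ vertex g b ⇔ y′ ⊑ vertex h b)
           (vertex-label g x) (trans (cong (vertex h) gx≡hy) (vertex-label h y)) (mk⇔ g⊑⇒h⊑ h⊑⇒g⊑)

  same-label : (∀ b → x ⊑ vertex g b ⇔ y ⊑ vertex h b) → label g x ≡ label h y
  same-label up = trans (sym (label-vertex h (label g x))) (cong (label h) (⊑-antisym below above))
    where
    above : y ⊑ vertex h (label g x)
    above = Equivalence.to (up (label g x)) (inj₁ (sym (vertex-label g x)))
    x⊑ : x ⊑ vertex g (label h y)
    x⊑ = Equivalence.from (up (label h y)) (inj₁ (sym (vertex-label h y)))
    below : vertex h (label g x) ⊑ y
    below = subst (vertex h (label g x) ⊑_) (vertex-label h y)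
                  (g⊑⇒h⊑ (subst (_⊑ vertex g (label h y)) (sym (vertex-label g x)) x⊑))

extend-SameOrder : ∀ {s v t s′ v′ t′ n} (E : s ⊲[ v ] t) (F : s′ ⊲[ v′ ] t′)
                   {g : Lab s n} {h : Lab s′ n} →
                   SameOrder (extend E g) (extend F h) ⇔ (SameOrder g h × label g v ≡ label h v′)
extend-SameOrder {v = v} {v′ = v′} {n = n} E F {g} {h} = mk⇔ forth back
  where
  forth : SameOrder (extend E g) (extend F h) → SameOrder g h × label g v ≡ label h v′
  forth E∼F = g∼h , Equivalence.to (SameOrder-up-set⇔label g∼h) parents
    where
    g∼h : SameOrder g h
    g∼h = same-order λ a b →
      ⇔.trans (⇔.sym (extend-⊏-inject₁ E g a b))
              (⇔.trans (⊏-⇔ E∼F (inject₁ a) (inject₁ b)) (extend-⊏-inject₁ F h a b))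
    parents : ∀ b → v ⊑ vertex g b ⇔ v′ ⊑ vertex h b
    parents b = ⇔.trans (⇔.sym (extend-fromℕ-⊏ E g b))
                        (⇔.trans (⊏-⇔ E∼F (fromℕ n) (inject₁ b)) (extend-fromℕ-⊏ F h b))

  back : SameOrder g h × label g v ≡ label h v′ → SameOrder (extend E g) (extend F h)
  back (g∼h , label-parent) = same-order λ a b → by-view (view a) (view b)
    where
    by-view : ∀ {a b} → View a → View b → a ⊏⟨ extend E g ⟩ b ⇔ a ⊏⟨ extend F h ⟩ b
    by-view {a} _ ‵fromℕ = mk⇔ (⊥-elim ∘ extend-⊄-fromℕ E g a) (⊥-elim ∘ extend-⊄-fromℕ F h a)
    by-view (‵inject₁ a′) (‵inject₁ b′) =
      ⇔.trans (extend-⊏-inject₁ E g a′ b′)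
              (⇔.trans (⊏-⇔ g∼h a′ b′) (⇔.sym (extend-⊏-inject₁ F h a′ b′)))
    by-view ‵fromℕ (‵inject₁ b′) =
      ⇔.trans (extend-fromℕ-⊏ E g b′)
              (⇔.trans (Equivalence.from (SameOrder-up-set⇔label g∼h) label-parent b′)
                       (⇔.sym (extend-fromℕ-⊏ F h b′)))

-- Order isomorphisms are tree isomorphisms

permute-injective : ∀ {k} (π : Permutation′ k) {i j} → π ⟨$⟩ʳ i ≡ π ⟨$⟩ʳ j → i ≡ j
permute-injective π e = trans (sym (Perm.inverseˡ π)) (trans (cong (π ⟨$⟩ˡ_) e) (Perm.inverseˡ π))

act-⊏ : ∀ {s t} (φ : Iso s t) {x y} → x ⊏ y → act φ x ⊏ act φ y
act-⊏ (iso π φs) below-root            = below-root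
act-⊏ (iso π φs) (below-sub {i = i} r) = below-sub (act-⊏ (φs i) r)

act-⊏⁻¹ : ∀ {s t} (φ : Iso s t) {x y} → act φ x ⊏ act φ y → x ⊏ y
act-⊏⁻¹ (iso π φs) {sub i p} {root}    _ = below-root
act-⊏⁻¹ (iso π φs) {sub i p} {sub j q} r with permute-injective π (below-sub-index r)
... | refl = below-sub (act-⊏⁻¹ (φs i) (below-sub⁻¹ r))

act-injective : ∀ {s t} (φ : Iso s t) {x y} → act φ x ≡ act φ y → x ≡ y
act-injective (iso π φs) {root}    {root}    _ = refl
act-injective (iso π φs) {sub i p} {sub j q} e with permute-injective π (sub-injectiveˡ e)
... | refl = cong (sub i) (act-injective (φs i) (sub-injectiveʳ e))

act-surjective : ∀ {s t} (φ : Iso s t) y → ∃ λ x → act φ x ≡ y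
act-surjective (iso π φs) root      = root , refl
act-surjective (iso π φs) (sub j q) = preimage (Perm.inverseʳ π) q
  where
  preimage : ∀ {i j} → π ⟨$⟩ʳ i ≡ j → ∀ q → ∃ λ x → act (iso π φs) x ≡ sub j q
  preimage {i} refl q = let p , e = act-surjective (φs i) q in sub i p , cong (sub _) e

pull : ∀ {s t n} → Iso s t → Lab t n → Lab s n
pull φ h = record
  { label = label h ∘ act φ
  ; vertex = λ a → proj₁ (act-surjective φ (vertex h a))
  ; label-vertex = λ a →
      trans (cong (label h) (proj₂ (act-surjective φ (vertex h a)))) (label-vertex h a)
  ; vertex-label = λ x →
      act-injective φ (trans (proj₂ (act-surjective φ _)) (vertex-label h (act φ x)))
  ; label-decreasing = label-decreasing h ∘ act-⊏ φ
  }

pull-SameOrder : ∀ {s t n} (φ : Iso s t) (h : Lab t n) → SameOrder (pull φ h) h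
pull-SameOrder φ h = same-order λ a b →
  mk⇔ (subst₂ _⊏_ (act-vertex a) (act-vertex b) ∘ act-⊏ φ)
      (act-⊏⁻¹ φ ∘ subst₂ _⊏_ (sym (act-vertex a)) (sym (act-vertex b)))
  where
  act-vertex : ∀ a → act φ (vertex (pull φ h) a) ≡ vertex h a
  act-vertex a = proj₂ (act-surjective φ (vertex h a))

childRoot : ∀ {k} {f : Fin k → Tree} → Fin k → Pos (node k f)
childRoot {f = f} i = sub i (rootOf (f i))

sub-⊑-childRoot : ∀ {k f} (i : Fin k) (p : Pos (f i)) → _⊑_ {node k f} (sub i p) (childRoot i)
sub-⊑-childRoot i p with ⊑-rootOf p
... | inj₁ refl     = inj₁ refl
... | inj₂ p⊏root = inj₂ (below-sub p⊏root)

⊑-childRoot⇒sub : ∀ {k f} {i : Fin k} {y : Pos (node k f)} → y ⊑ childRoot i →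
                  ∃ λ p → sub i p ≡ y
⊑-childRoot⇒sub (inj₁ refl)                  = _ , refl
⊑-childRoot⇒sub (inj₂ (below-sub {p = p} _)) = p , refl

childRoot-⊑⇒≡ : ∀ {k f} {i : Fin k} {x : Pos (node k f)} → childRoot i ⊑ x → x ≢ root →
                childRoot i ≡ x
childRoot-⊑⇒≡ (inj₁ e)                  _      = e
childRoot-⊑⇒≡ (inj₂ below-root)         x≢root = contradiction refl x≢root
childRoot-⊑⇒≡ (inj₂ (below-sub root⊏)) _      = contradiction root⊏ rootOf-⊏-maximal

branchOf : ∀ {k f} (y : Pos (node k f)) → y ≢ root → Fin k
branchOf root      y≢root = contradiction refl y≢root
branchOf (sub j _) _      = j

⊑-childRoot-branchOf : ∀ {k f} (y : Pos (node k f)) (y≢root : y ≢ root) →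
                       y ⊑ childRoot (branchOf y y≢root)
⊑-childRoot-branchOf root      y≢root = contradiction refl y≢root
⊑-childRoot-branchOf (sub j q) _      = sub-⊑-childRoot j q

branchOf-childRoot : ∀ {k f} {i : Fin k} {y : Pos (node k f)} → childRoot i ≡ y →
                     (y≢root : y ≢ root) → branchOf y y≢root ≡ i
branchOf-childRoot refl _ = refl

⊏-iso-root : ∀ {k k′} {f : Fin k → Tree} {g : Fin k′ → Tree}
             (ψ : Pos (node k f) → Pos (node k′ g)) (χ : Pos (node k′ g) → Pos (node k f)) →
             (∀ x → χ (ψ x) ≡ x) → (∀ {x y} → x ⊏ y → χ x ⊏ χ y) → ψ root ≡ root
⊏-iso-root ψ χ χψ χ-⊏ with ψ root in e
... | root    = refl
... | sub j q = contradiction (subst (_⊏ χ root) χ-sub≡root (χ-⊏ (below-root {p = q}))) λ ()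
  where
  χ-sub≡root : χ (sub j q) ≡ root
  χ-sub≡root = trans (cong χ (sym e)) (χψ root)

⊏-preserving-sub≢root : ∀ {k k′} {f : Fin k → Tree} {g : Fin k′ → Tree}
                        (ψ : Pos (node k f) → Pos (node k′ g)) → ψ root ≡ root →
                        (∀ {x y} → x ⊏ y → ψ x ⊏ ψ y) → ∀ {i p} → ψ (sub i p) ≢ root
⊏-preserving-sub≢root ψ ψ-root ψ-⊏ e = ⊏-irrefl (subst₂ _⊏_ e ψ-root (ψ-⊏ below-root))

module _ {k k′} {f : Fin k → Tree} {g : Fin k′ → Tree} where

  -- ψ sends each branch sub i _ into a single branch sub (π i) _, since the branch lies below childRoot i.
  module ⊏-Iso (ψ : Pos (node k f) → Pos (node k′ g)) (χ : Pos (node k′ g) → Pos (node k f))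
               (χψ : ∀ x → χ (ψ x) ≡ x) (ψχ : ∀ y → ψ (χ y) ≡ y)
               (ψ-⊏ : ∀ {x y} → x ⊏ y → ψ x ⊏ ψ y)
               (χ-⊏ : ∀ {x y} → x ⊏ y → χ x ⊏ χ y) where

    ψ-⊑ : ∀ {x y} → x ⊑ y → ψ x ⊑ ψ y
    ψ-⊑ (inj₁ refl) = inj₁ refl
    ψ-⊑ (inj₂ x⊏y) = inj₂ (ψ-⊏ x⊏y)

    χ-⊑ : ∀ {x y} → x ⊑ y → χ x ⊑ χ y
    χ-⊑ (inj₁ refl) = inj₁ refl
    χ-⊑ (inj₂ x⊏y) = inj₂ (χ-⊏ x⊏y)

    ψ-sub≢root : ∀ {i p} → ψ (sub i p) ≢ root
    ψ-sub≢root = ⊏-preserving-sub≢root ψ (⊏-iso-root ψ χ χψ χ-⊏) ψ-⊏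

    χ-sub≢root : ∀ {j q} → χ (sub j q) ≢ root
    χ-sub≢root = ⊏-preserving-sub≢root χ (⊏-iso-root χ ψ ψχ ψ-⊏) χ-⊏

    π : Fin k → Fin k′
    π i = branchOf (ψ (childRoot i)) ψ-sub≢root

    ψ-childRoot : ∀ i → ψ (childRoot i) ⊑ childRoot (π i)
    ψ-childRoot i = ⊑-childRoot-branchOf _ ψ-sub≢root

    χ-childRoot : ∀ i → childRoot i ≡ χ (childRoot (π i))
    χ-childRoot i =
      childRoot-⊑⇒≡ (subst (_⊑ χ (childRoot (π i))) (χψ (childRoot i)) (χ-⊑ (ψ-childRoot i)))
                    χ-sub≢root

    π⁻¹ : Fin k′ → Fin k
    π⁻¹ j = branchOf (χ (childRoot j)) χ-sub≢root

    π⁻¹-π : ∀ i → π⁻¹ (π i) ≡ i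
    π⁻¹-π i = branchOf-childRoot (χ-childRoot i) χ-sub≢root

    ψ-branch : ∀ i p → ∃ λ q → sub (π i) q ≡ ψ (sub i p)
    ψ-branch i p = ⊑-childRoot⇒sub (⊑-trans (ψ-⊑ (sub-⊑-childRoot i p)) (ψ-childRoot i))

    χ-branch : ∀ i q → ∃ λ p → sub i p ≡ χ (sub (π i) q)
    χ-branch i q = ⊑-childRoot⇒sub (subst (χ (sub (π i) q) ⊑_) (sym (χ-childRoot i))
                                          (χ-⊑ (sub-⊑-childRoot (π i) q)))

    ψᵢ : ∀ i → Pos (f i) → Pos (g (π i))
    ψᵢ i = proj₁ ∘ ψ-branch i

    sub-ψᵢ : ∀ i p → sub (π i) (ψᵢ i p) ≡ ψ (sub i p)
    sub-ψᵢ i = proj₂ ∘ ψ-branch i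

    χᵢ : ∀ i → Pos (g (π i)) → Pos (f i)
    χᵢ i = proj₁ ∘ χ-branch i

    sub-χᵢ : ∀ i q → sub i (χᵢ i q) ≡ χ (sub (π i) q)
    sub-χᵢ i = proj₂ ∘ χ-branch i

    χᵢ-ψᵢ : ∀ i p → χᵢ i (ψᵢ i p) ≡ p
    χᵢ-ψᵢ i p = sub-injectiveʳ (trans (sub-χᵢ i _) (trans (cong χ (sub-ψᵢ i p)) (χψ (sub i p))))

    ψᵢ-χᵢ : ∀ i q → ψᵢ i (χᵢ i q) ≡ q
    ψᵢ-χᵢ i q = sub-injectiveʳ (trans (sub-ψᵢ i _) (trans (cong ψ (sub-χᵢ i q)) (ψχ (sub (π i) q))))

    ψᵢ-⊏ : ∀ i {p p′} → p ⊏ p′ → ψᵢ i p ⊏ ψᵢ i p′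
    ψᵢ-⊏ i r = below-sub⁻¹ (subst₂ _⊏_ (sym (sub-ψᵢ i _)) (sym (sub-ψᵢ i _)) (ψ-⊏ (below-sub r)))

    χᵢ-⊏ : ∀ i {q q′} → q ⊏ q′ → χᵢ i q ⊏ χᵢ i q′
    χᵢ-⊏ i r = below-sub⁻¹ (subst₂ _⊏_ (sym (sub-χᵢ i _)) (sym (sub-χᵢ i _)) (χ-⊏ (below-sub r)))

⊏-iso⇒Iso : ∀ s t (ψ : Pos s → Pos t) (χ : Pos t → Pos s) →
            (∀ x → χ (ψ x) ≡ x) → (∀ y → ψ (χ y) ≡ y) →
            (∀ {x y} → x ⊏ y → ψ x ⊏ ψ y) → (∀ {x y} → x ⊏ y → χ x ⊏ χ y) →
            Σ (Iso s t) λ φ → ∀ x → act φ x ≡ ψ x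
⊏-iso⇒Iso (node k f) (node k′ g) ψ χ χψ ψχ ψ-⊏ χ-⊏ = assemble (Perm.↔⇒≡ ρ)
  where
  module Ψ = ⊏-Iso {k} {k′} {f} {g} ψ χ χψ ψχ ψ-⊏ χ-⊏
  module Χ = ⊏-Iso {k′} {k} {g} {f} χ ψ ψχ χψ χ-⊏ ψ-⊏
  ρ : Permutation k k′
  ρ = Perm.permutation Ψ.π Ψ.π⁻¹ Χ.π⁻¹-π Ψ.π⁻¹-π
  branches : ∀ i → Σ (Iso (f i) (g (Ψ.π i))) λ φ → ∀ x → act φ x ≡ Ψ.ψᵢ i x
  branches i = ⊏-iso⇒Iso (f i) (g (Ψ.π i)) (Ψ.ψᵢ i) (Ψ.χᵢ i) (Ψ.χᵢ-ψᵢ i) (Ψ.ψᵢ-χᵢ i)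
                         (Ψ.ψᵢ-⊏ i) (Ψ.χᵢ-⊏ i)
  assemble : k ≡ k′ → Σ (Iso (node k f) (node k′ g)) λ φ → ∀ x → act φ x ≡ ψ x
  assemble refl = iso ρ (proj₁ ∘ branches) , act-ψ
    where
    act-ψ : ∀ x → act (iso ρ (proj₁ ∘ branches)) x ≡ ψ x
    act-ψ root      = sym (⊏-iso-root ψ χ χψ χ-⊏)
    act-ψ (sub i p) = trans (cong (sub (Ψ.π i)) (proj₂ (branches i) p)) (Ψ.sub-ψᵢ i p)

SameOrder⇒Iso : ∀ {s t n} {g : Lab s n} {h : Lab t n} → SameOrder g h →
                Σ (Iso s t) λ φ → ∀ x → label h (act φ x) ≡ label g x
SameOrder⇒Iso {s} {t} {n} {g} {h} g∼h =
  let φ , act≡ = ⊏-iso⇒Iso s t (vertex h ∘ label g) (vertex g ∘ label h) χψ ψχ ψ-⊏ χ-⊏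
  in φ , λ x → trans (cong (label h) (act≡ x)) (label-vertex h (label g x))
  where
  χψ : ∀ x → vertex g (label h (vertex h (label g x))) ≡ x
  χψ x = trans (cong (vertex g) (label-vertex h (label g x))) (vertex-label g x)
  ψχ : ∀ y → vertex h (label g (vertex g (label h y))) ≡ y
  ψχ y = trans (cong (vertex h) (label-vertex g (label h y))) (vertex-label h y)
  as-labels : ∀ {u} (l : Lab u n) {x y} → x ⊏ y → label l x ⊏⟨ l ⟩ label l y
  as-labels l = subst₂ _⊏_ (sym (vertex-label l _)) (sym (vertex-label l _))
  ψ-⊏ : ∀ {x y} → x ⊏ y → vertex h (label g x) ⊏ vertex h (label g y)
  ψ-⊏ = Equivalence.to (⊏-⇔ g∼h _ _) ∘ as-labels g
  χ-⊏ : ∀ {x y} → x ⊏ y → vertex g (label h x) ⊏ vertex g (label h y)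
  χ-⊏ = Equivalence.from (⊏-⇔ g∼h _ _) ∘ as-labels h

-- Growth codes

-- A code p : Code n lists the vertices at which n successive leaves are grafted onto •.
mutual
  Code : ℕ → Set
  Code zero    = ⊤
  Code (suc n) = Σ (Code n) (Pos ∘ build)

  build : ∀ {n} → Code n → Tree
  build {zero}  _       = •
  build {suc n} (p , v) = graft (build p) v

codes : ∀ n → List (Code n)
codes zero    = tt ∷ []
codes (suc n) = concatMap (λ p → map (p ,_) (vertices (build p))) (codes n)

codes-complete : ∀ {n} (p : Code n) → p ∈ codes n
codes-complete {zero}  tt      = here refl
codes-complete {suc n} (p , v) = ∈-concatMap-map _,_ (codes-complete p) (vertices-complete v)

codes-unique : ∀ n → Unique (codes n)
codes-unique zero    = [] ∷ []
codes-unique (suc n) =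
  unique-concatMap-map _,_ (cong proj₁) (λ { refl → refl }) (vertices ∘ build)
                       (codes-unique n) (vertices-unique ∘ build)

iter-𝔑 : ∀ n → iter n 𝔑* (• ∷ []) ≡ map build (codes n)
iter-𝔑 zero    = refl
iter-𝔑 (suc n) = begin
  𝔑* (iter n 𝔑* (• ∷ []))            ≡⟨ cong 𝔑* (iter-𝔑 n) ⟩
  concatMap 𝔑 (map build (codes n))  ≡⟨ List.concatMap-map 𝔑 build (codes n) ⟩
  concatMap (𝔑 ∘ build) (codes n)    ≡⟨ List.concatMap-cong 𝔑-build (codes n) ⟩
  concatMap (λ p → map build (map (p ,_) (vertices (build p)))) (codes n)
                                     ≡⟨ List.map-concatMap build _ (codes n) ⟨
  map build (codes (suc n))          ∎
  where
  open ≡-Reasoning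
  𝔑-build : ∀ p → 𝔑 (build p) ≡ map build (map (p ,_) (vertices (build p)))
  𝔑-build p = List.map-∘ (vertices (build p))

-- Every vertex is labelled by the step at which it was grafted.
canonical : ∀ {n} (p : Code n) → Lab (build p) (suc n)
canonical {zero}  _       = childless-lab
canonical {suc n} (p , v) = extend (graft-⊲ (build p) v) (canonical p)

canonical-injective : ∀ {n} (p p′ : Code n) → SameOrder (canonical p) (canonical p′) → p ≡ p′
canonical-injective {zero}  tt      tt        _ = refl
canonical-injective {suc n} (p , v) (p′ , v′) same
  with Equivalence.to (extend-SameOrder (graft-⊲ (build p) v) (graft-⊲ (build p′) v′)) same
... | p∼p′ , label-v with canonical-injective p p′ p∼p′
...   | refl = cong (p ,_) (label-injective (canonical p) label-v)

⊏⟨⟩⇒> : ∀ {t n} (g : Lab t n) {a b} → a ⊏⟨ g ⟩ b → b <ᶠ a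
⊏⟨⟩⇒> g {a} {b} r = subst₂ _<ᶠ_ (label-vertex g b) (label-vertex g a) (label-decreasing g r)

code-exists : ∀ n {t} (h : Lab t (suc n)) → ∃ λ p → SameOrder (canonical p) h
code-exists zero h =
  tt , same-order λ { zero zero → mk⇔ (⊥-elim ∘ 0≮0 childless-lab) (⊥-elim ∘ 0≮0 h) }
  where
  0≮0 : ∀ {t} (g : Lab t 1) → ¬ zero ⊏⟨ g ⟩ zero
  0≮0 g r = ℕ.<-irrefl refl (⊏⟨⟩⇒> g r)
code-exists (suc n) {t} h with top-removable h
... | s , removed with removeLeaf-⊲ t (top h) removed
...   | u , E , leaf≡top with code-exists n (restrict E h (sym leaf≡top))
...     | p , p∼h′ = (p , x) , SameOrder-trans same (≋⇒SameOrder (extend-restrict E h (sym leaf≡top)))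
  where
  h′ : Lab s (suc n)
  h′ = restrict E h (sym leaf≡top)
  x : Pos (build p)
  x = vertex (canonical p) (label h′ u)
  same : SameOrder (canonical (p , x)) (extend E h′)
  same = Equivalence.from (extend-SameOrder (graft-⊲ (build p) x) E)
                          (p∼h′ , label-vertex (canonical p) (label h′ u))

toLab : ∀ {t} → Labelling t → Lab t (size t)
toLab g = record
  { label = lab g
  ; vertex = λ a → proj₁ (proj₂ (bijective g) a)
  ; label-vertex = λ a → proj₂ (proj₂ (bijective g) a) refl
  ; vertex-label = λ x → proj₁ (bijective g) (proj₂ (proj₂ (bijective g) (lab g x)) refl)
  ; label-decreasing = decreasing g }

fromLab : ∀ {t} → Lab t (size t) → Labelling t
fromLab g = labelling (label g)
  (label-injective g , λ a → vertex g a , λ z≡ → trans (cong (label g) z≡) (label-vertex g a))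
  (label-decreasing g)

toLab-fromLab : ∀ {t} (g : Lab t (size t)) → toLab (fromLab g) ≋ g
toLab-fromLab g _ = refl

-- Matching t against node makes size t and suc (size t ∸ 1) definitionally equal.
labellings-count : ∀ t → HasCard (Labelling t) _≐_ (length (iter (size t ∸ 1) 𝔓* (t ∷ [])))
labellings-count t@(node k f) =
  HasCard-transport ≋-isEquivalence toLab id id (λ g → fromLab g , toLab-fromLab g) (Lab-count _ t refl)

size-𝔓 : ∀ m t → size t ≡ suc (suc m) → All (λ s → size s ≡ suc m) (𝔓 t)
size-𝔓 m t size≡ = All.mapMaybe⁺ (All.map⁺ (All.universal deleted (vertices t)))
  where
  deleted : ∀ w → MaybeAll.All (λ s → size s ≡ suc m) (removeLeaf t w)
  deleted w with removeLeaf t w in removed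
  ... | nothing = nothing
  ... | just s  = let _ , E , _ = removeLeaf-⊲ t w removed in
                  just (ℕ.suc-injective (trans (sym (size-⊲ E)) size≡))

size-iter-𝔓 : ∀ m xs → All (λ s → size s ≡ suc m) xs →
              All (λ s → size s ≡ 1) (iter m 𝔓* xs)
size-iter-𝔓 zero    xs sizes = sizes
size-iter-𝔓 (suc m) xs sizes = subst (All (λ s → size s ≡ 1)) (sym (iter-suc m 𝔓* xs))
  (size-iter-𝔓 m (𝔓* xs) (All.concat⁺ (All.map⁺ (All.map (size-𝔓 m _) sizes))))

Coeff-• : ∀ xs → All (λ s → size s ≡ 1) xs → Coeff • xs (length xs)
Coeff-• []                 []             = c-nil
Coeff-• (node k g ∷ xs) (size≡1 ∷ sizes) with size≡1⇒childless {k} {g} size≡1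
... | refl = c-yes (iso Perm.id λ ()) (Coeff-• xs sizes)

Iso-dec : ∀ {s t n c} → HasCard (Lab s n) _≋_ c → Lab t n → Dec (Iso s t)
Iso-dec (e , _ , e-surjective) h with Fin.any? (λ i → SameOrder? (e i) h)
... | yes (i , ei∼h) = yes (proj₁ (SameOrder⇒Iso ei∼h))
... | no ≁           = no λ φ →
  let i , ei≋ = e-surjective (pull φ h)
  in ≁ (i , SameOrder-trans (≋⇒SameOrder ei≋) (pull-SameOrder φ h))

Coeff-filter : ∀ {X : Set} {t} (F : X → Tree) (Iso? : ∀ x → Dec (Iso t (F x))) xs →
               Coeff t (map F xs) (length (filter Iso? xs))
Coeff-filter F Iso? []       = c-nil
Coeff-filter F Iso? (x ∷ xs) with Iso? x
... | yes φ = c-yes φ (Coeff-filter F Iso? xs)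
... | no ¬φ = c-no ¬φ (Coeff-filter F Iso? xs)

∼⇒SameOrder : ∀ {t} {g h : Labelling t} → g ∼ h → SameOrder (toLab g) (toLab h)
∼⇒SameOrder {g = g} (φ , φ-eq) =
  SameOrder-trans (SameOrder-sym (pull-SameOrder φ (toLab g))) (≋⇒SameOrder φ-eq)

SameOrder⇒∼ : ∀ {t} {g h : Labelling t} → SameOrder (toLab g) (toLab h) → g ∼ h
SameOrder⇒∼ g∼h = SameOrder⇒Iso (SameOrder-sym g∼h)

classes-count : ∀ t (Iso? : ∀ p → Dec (Iso t (build p))) →
                HasCard (Labelling t) _∼_ (length (filter Iso? (codes (size t ∸ 1))))
classes-count t@(node k f) Iso? =
  HasCard-transport (On.isEquivalence proj₁ isEquivalence) code-of
    (λ {g} {h} → code-cong g h) (λ {g} {h} → code-reflect g h) code-surjective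
    (HasCard-filter Iso? (codes-unique n) codes-complete)
  where
  n : ℕ
  n = size t ∸ 1
  code : (g : Labelling t) → ∃ λ p → SameOrder (canonical p) (toLab g)
  code g = code-exists n (toLab g)
  code-of : Labelling t → Σ (Code n) λ p → Iso t (build p)
  code-of g = let p , p∼g = code g in p , proj₁ (SameOrder⇒Iso (SameOrder-sym p∼g))
  code-cong : ∀ g h → g ∼ h → proj₁ (code g) ≡ proj₁ (code h)
  code-cong g h g∼h = let p , p∼g = code g; q , q∼h = code h in
    canonical-injective p q
      (SameOrder-trans p∼g (SameOrder-trans (∼⇒SameOrder {g = g} {h} g∼h) (SameOrder-sym q∼h)))
  code-reflect : ∀ g h → proj₁ (code g) ≡ proj₁ (code h) → g ∼ h
  code-reflect g h p≡q = let p , p∼g = code g; q , q∼h = code h in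
    SameOrder⇒∼ {g = g} {h}
      (SameOrder-trans (SameOrder-sym p∼g) (subst (λ r → SameOrder (canonical r) (toLab h)) (sym p≡q) q∼h))
  code-surjective : ∀ b → ∃ λ g → proj₁ (code g) ≡ proj₁ b
  code-surjective (p , φ) = let g = fromLab (pull φ (canonical p)); q , q∼g = code g in
    g , canonical-injective q p
          (SameOrder-trans q∼g (SameOrder-trans (≋⇒SameOrder (toLab-fromLab (pull φ (canonical p))))
                                                (pull-SameOrder φ (canonical p))))

proposition2p6 : (t : Tree) →
    (Σ ℕ λ c → Coeff • (iter (size t ∸ 1) 𝔓* (t ∷ [])) c × HasCard (Labelling t) _≐_ c)
    × (Σ ℕ λ c → Coeff t (iter (size t ∸ 1) 𝔑* (• ∷ [])) c × HasCard (Labelling t) _∼_ c)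
proposition2p6 t@(node k f) =
    (_ , Coeff-• _ (size-iter-𝔓 n (t ∷ []) (refl ∷ [])) , labellings-count t)
  , (_ , coeff-t , classes-count t Iso?)
  where
  n : ℕ
  n = size t ∸ 1
  Iso? : ∀ p → Dec (Iso t (build p))
  Iso? p = Iso-dec (Lab-count n t refl) (canonical p)
  coeff-t : Coeff t (iter n 𝔑* (• ∷ [])) (length (filter Iso? (codes n)))
  coeff-t rewrite iter-𝔑 n = Coeff-filter build Iso? (codes n)
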